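{- For every prime $m$, the function $g_m:\mathbb{N}\to\mathbb{N}$ is injective.
   Context: $\mathbb{N}=\{0,1,2,\dots\}$. For an integer $m\ge 2$, an $m$-product sequence is a finite sequence of integers $a_1\le a_2\le\dots\le a_t$ such that $\prod_{i=1}^t a_i=R^m$ for some $R\in\mathbb{N}$ and no integer appears more than $m-1$ times in the sequence. For $n\in\mathbb{N}$, $g_m(n)$ is the least integer $s$ such that there exists an $m$-product sequence $a_1\le\dots\le a_t$ with $a_1=n$ and $a_t=s$. -}

module Defs where

open import Data.Nat using (ℕ; _≤_; _<_; _^_; _≟_)
open import Data.List using (List; []; _∷_; length; filter; last)
open import Data.Nat.ListAction using (product)
open import Data.List.Relation.Unary.Linked using (Linked)
open import Data.Maybe using (just)
open import Data.Product using (Σ; ∃; _×_)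
open import Relation.Binary.PropositionalEquality using (_≡_)

occ : ℕ → List ℕ → ℕ
occ x xs = length (filter (x ≟_) xs)

-- Entries are taken in ℕ: in all uses a₁ = n ∈ ℕ, so all entries are ≥ 0.
IsProductSeq : ℕ → List ℕ → Set
IsProductSeq m as =
  Linked _≤_ as × (∃ λ R → product as ≡ R ^ m) × (∀ x → occ x as < m)

Reaches : ℕ → ℕ → ℕ → Set
Reaches m n s = Σ (List ℕ) λ rest →
  IsProductSeq m (n ∷ rest) × last (n ∷ rest) ≡ just s

-- g_m(n) = s : s is the least such value
IsG : ℕ → ℕ → ℕ → Set
IsG m n s = Reaches m n s × (∀ s' → Reaches m n s' → s ≤ s')

-- Suppose g_m(n) = g_m(n') = s with n < n', witnessed by m-product sequences A from n and B from n',
-- and let a x, b x count the occurrences of x in A and B. Every entry lies in [n, s], so the exponents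
-- c x = j · a x + i · b x with j = b s and i = m − a s describe an m-th power (A^j B^i) in which s
-- occurs exactly j m times. Reducing all exponents modulo m keeps the product an m-th power, deletes s,
-- and keeps n: b n = 0, and j · a n is not divisible by the prime m because 0 < j, a n < m. The
-- resulting sequence starts at n and ends below s, contradicting minimality; n = 0 is excluded since
-- g_m(0) = 0 via the sequence (0).
module Submission where

open import Defs
open import Data.Nat
open import Data.Nat.Properties
open import Data.Nat.Divisibility using (_∣_; divides; ∣1⇒≡1; >⇒∤; m%n≡0⇒n∣m)
open import Data.Nat.DivMod using (_/_; _%_; m/n*n≡m; m≡m%n+[m/n]*n; m%n<n)
open import Data.Nat.GCD using (gcd; gcd[m,n]∣m; gcd[m,n]∣n; gcd[m,n]≢0)
open import Data.Nat.Coprimality using (Coprime; coprime-/gcd; coprime-divisor)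
open import Data.Nat.Primality using (Prime; euclidsLemma; prime⇒nonZero; prime⇒nonTrivial)
open import Data.Nat.ListAction using (product)
open import Data.Nat.ListAction.Properties using (product-++)
open import Algebra.Properties.CommutativeSemigroup *-commutativeSemigroup using (interchange; x∙yz≈y∙xz)
open import Data.List using (List; []; _∷_; length; filter; last; replicate; _++_)
open import Data.List.Properties using (filter-accept; filter-reject; filter-++; length-++; length-filter)
open import Data.List.Relation.Unary.All as All using (All; []; _∷_)
open import Data.List.Relation.Unary.All.Properties using (++⁺; replicate⁺)
open import Data.List.Relation.Unary.Linked using (Linked; []; [-]; _∷_)
open import Data.List.Relation.Unary.Linked.Properties using (Linked⇒All)
open import Data.Maybe using (just)
open import Data.Product using (∃-syntax; _×_; _,_; proj₁; proj₂)
open import Data.Sum using (inj₁; inj₂)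
open import Relation.Nullary using (¬_; yes; no; contradiction)
open import Relation.Binary.Definitions using (tri<; tri≈; tri>)
open import Relation.Binary.PropositionalEquality

^-distribʳ-* : ∀ a b n → (a * b) ^ n ≡ a ^ n * b ^ n
^-distribʳ-* a b zero    = refl
^-distribʳ-* a b (suc n) = begin
  a * b * (a * b) ^ n     ≡⟨ cong (a * b *_) (^-distribʳ-* a b n) ⟩
  a * b * (a ^ n * b ^ n) ≡⟨ interchange a b (a ^ n) (b ^ n) ⟩
  a ^ suc n * b ^ suc n   ∎
  where open ≡-Reasoning

^-swap : ∀ a m n → (a ^ m) ^ n ≡ (a ^ n) ^ m
^-swap a m n = begin
  (a ^ m) ^ n ≡⟨ ^-*-assoc a m n ⟩
  a ^ (m * n) ≡⟨ cong (a ^_) (*-comm m n) ⟩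
  a ^ (n * m) ≡⟨ ^-*-assoc a n m ⟨
  (a ^ n) ^ m ∎
  where open ≡-Reasoning

coprime-∣^⇒∣1 : ∀ {t u} k → Coprime t u → t ∣ u ^ k → t ∣ 1
coprime-∣^⇒∣1 zero    _   t∣1   = t∣1
coprime-∣^⇒∣1 (suc k) t⊥u t∣u^k = coprime-∣^⇒∣1 k t⊥u (coprime-divisor t⊥u t∣u^k)

-- Write T = t g and U = u g with g = gcd T U; then a t^m = u^m with t, u coprime forces t = 1.
*-^-cancel-power : ∀ m a T U .{{_ : NonZero T}} → a * T ^ m ≡ U ^ m → ∃[ R ] a ≡ R ^ m
*-^-cancel-power zero      a T U eq = 0 , trans (sym (*-identityʳ a)) eq
*-^-cancel-power m@(suc k) a T U eq = u , a≡u^m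
  where
  g = gcd T U
  instance
    g≢0 : NonZero g
    g≢0 = ≢-nonZero (gcd[m,n]≢0 T U (inj₁ (≢-nonZero⁻¹ T)))
    g^m≢0 : NonZero (g ^ m)
    g^m≢0 = m^n≢0 g m
  t = T / g
  u = U / g
  at^m≡u^m : a * t ^ m ≡ u ^ m
  at^m≡u^m = *-cancelʳ-≡ _ _ (g ^ m) (begin
    a * t ^ m * g ^ m   ≡⟨ *-assoc a _ _ ⟩
    a * (t ^ m * g ^ m) ≡⟨ cong (a *_) (^-distribʳ-* t g m) ⟨
    a * (t * g) ^ m     ≡⟨ cong (λ z → a * z ^ m) (m/n*n≡m (gcd[m,n]∣m T U)) ⟩
    a * T ^ m           ≡⟨ eq ⟩
    U ^ m               ≡⟨ cong (_^ m) (m/n*n≡m (gcd[m,n]∣n T U)) ⟨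
    (u * g) ^ m         ≡⟨ ^-distribʳ-* u g m ⟩
    u ^ m * g ^ m       ∎)
    where open ≡-Reasoning
  t∣u^m : t ∣ u ^ m
  t∣u^m = divides (a * t ^ k) (begin
    u ^ m           ≡⟨ at^m≡u^m ⟨
    a * (t * t ^ k) ≡⟨ cong (a *_) (*-comm t _) ⟩
    a * (t ^ k * t) ≡⟨ *-assoc a _ t ⟨
    a * t ^ k * t   ∎)
    where open ≡-Reasoning
  t≡1 : t ≡ 1
  t≡1 = ∣1⇒≡1 (coprime-∣^⇒∣1 m (coprime-/gcd T U) t∣u^m)
  a≡u^m : a ≡ u ^ m
  a≡u^m = begin
    a           ≡⟨ *-identityʳ a ⟨
    a * 1       ≡⟨ cong (a *_) (^-zeroˡ m) ⟨
    a * 1 ^ m   ≡⟨ cong (λ z → a * z ^ m) t≡1 ⟨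
    a * t ^ m   ≡⟨ at^m≡u^m ⟩
    u ^ m       ∎
    where open ≡-Reasoning

∏[_,+_]_ : ℕ → ℕ → (ℕ → ℕ) → ℕ
∏[ lo ,+ zero  ] f = 1
∏[ lo ,+ suc k ] f = f lo * ∏[ suc lo ,+ k ] f

InRange : ℕ → ℕ → ℕ → Set
InRange lo k y = lo ≤ y × y < lo + k

∏-cong : ∀ {f g} lo k → (∀ x → lo ≤ x → f x ≡ g x) → ∏[ lo ,+ k ] f ≡ ∏[ lo ,+ k ] g
∏-cong lo zero    f≗g = refl
∏-cong lo (suc k) f≗g =
  cong₂ _*_ (f≗g lo ≤-refl) (∏-cong (suc lo) k (λ x lo<x → f≗g x (<⇒≤ lo<x)))

∏-1 : ∀ lo k → ∏[ lo ,+ k ] (λ _ → 1) ≡ 1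
∏-1 lo zero    = refl
∏-1 lo (suc k) = trans (+-identityʳ _) (∏-1 (suc lo) k)

∏-distrib-* : ∀ f g lo k → ∏[ lo ,+ k ] (λ x → f x * g x) ≡ ∏[ lo ,+ k ] f * ∏[ lo ,+ k ] g
∏-distrib-* f g lo zero    = refl
∏-distrib-* f g lo (suc k) =
  trans (cong (f lo * g lo *_) (∏-distrib-* f g (suc lo) k)) (interchange (f lo) (g lo) _ _)

∏-distrib-^ : ∀ f n lo k → ∏[ lo ,+ k ] (λ x → f x ^ n) ≡ (∏[ lo ,+ k ] f) ^ n
∏-distrib-^ f n lo zero    = sym (^-zeroˡ n)
∏-distrib-^ f n lo (suc k) =
  trans (cong (f lo ^ n *_) (∏-distrib-^ f n (suc lo) k)) (sym (^-distribʳ-* (f lo) _ n))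

∏-suc : ∀ f lo k → ∏[ lo ,+ suc k ] f ≡ ∏[ lo ,+ k ] f * f (lo + k)
∏-suc f lo zero    = trans (*-comm (f lo) 1) (cong (λ z → 1 * f z) (sym (+-identityʳ lo)))
∏-suc f lo (suc k) = begin
  f lo * ∏[ suc lo ,+ suc k ] f               ≡⟨ cong (f lo *_) (∏-suc f (suc lo) k) ⟩
  f lo * (∏[ suc lo ,+ k ] f * f (suc lo + k)) ≡⟨ *-assoc (f lo) _ _ ⟨
  ∏[ lo ,+ suc k ] f * f (suc lo + k)         ≡⟨ cong (λ z → ∏[ lo ,+ suc k ] f * f z) (+-suc lo k) ⟨
  ∏[ lo ,+ suc k ] f * f (lo + suc k)         ∎
  where open ≡-Reasoning

∏-nonZero : ∀ f lo k → (∀ x → lo ≤ x → NonZero (f x)) → NonZero (∏[ lo ,+ k ] f)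
∏-nonZero f lo zero    f≢0 = _
∏-nonZero f lo (suc k) f≢0 =
  m*n≢0 _ _ {{f≢0 lo ≤-refl}} {{∏-nonZero f (suc lo) k (λ x lo<x → f≢0 x (<⇒≤ lo<x))}}

∏-update : ∀ f g y lo k → InRange lo k y → g y ≡ y * f y → (∀ x → x ≢ y → g x ≡ f x) →
           ∏[ lo ,+ k ] g ≡ y * ∏[ lo ,+ k ] f
∏-update f g y lo zero (lo≤y , y<lo+0) _ _ =
  contradiction (subst (y <_) (+-identityʳ lo) y<lo+0) (≤⇒≯ lo≤y)
∏-update f g y lo (suc k) (lo≤y , y<lo+k) gy gx with lo ≟ y
... | yes refl = begin
  g lo * ∏[ suc lo ,+ k ] g      ≡⟨ cong₂ _*_ gy (∏-cong (suc lo) k (λ x lo<x → gx x (>⇒≢ lo<x))) ⟩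
  lo * f lo * ∏[ suc lo ,+ k ] f ≡⟨ *-assoc lo _ _ ⟩
  lo * ∏[ lo ,+ suc k ] f        ∎
  where open ≡-Reasoning
... | no lo≢y = begin
  g lo * ∏[ suc lo ,+ k ] g       ≡⟨ cong₂ _*_ (gx lo lo≢y) (∏-update f g y (suc lo) k y∈ gy gx) ⟩
  f lo * (y * ∏[ suc lo ,+ k ] f) ≡⟨ x∙yz≈y∙xz (f lo) y _ ⟩
  y * ∏[ lo ,+ suc k ] f          ∎
  where
  open ≡-Reasoning
  y∈ : InRange (suc lo) k y
  y∈ = ≤∧≢⇒< lo≤y lo≢y , subst (y <_) (+-suc lo k) y<lo+k

occ-here : ∀ x ys → occ x (x ∷ ys) ≡ suc (occ x ys)
occ-here x ys = cong length (filter-accept (x ≟_) refl)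

occ-there : ∀ {x y} ys → x ≢ y → occ x (y ∷ ys) ≡ occ x ys
occ-there {x} ys x≢y = cong length (filter-reject (x ≟_) x≢y)

occ-≤-∷ : ∀ x y ys → occ x ys ≤ occ x (y ∷ ys)
occ-≤-∷ x y ys with x ≟ y
... | yes refl = ≤-trans (n≤1+n _) (≤-reflexive (sym (occ-here x ys)))
... | no x≢y   = ≤-reflexive (sym (occ-there ys x≢y))

occ-++ : ∀ x xs ys → occ x (xs ++ ys) ≡ occ x xs + occ x ys
occ-++ x xs ys = trans (cong length (filter-++ (x ≟_) xs ys)) (length-++ (filter (x ≟_) xs))

occ-absent : ∀ {x ys} → All (x ≢_) ys → occ x ys ≡ 0
occ-absent []           = refl
occ-absent (x≢y ∷ x∉ys) = trans (occ-there _ x≢y) (occ-absent x∉ys)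

occ-replicate : ∀ x c → occ x (replicate c x) ≡ c
occ-replicate x zero    = refl
occ-replicate x (suc c) = trans (occ-here x _) (cong suc (occ-replicate x c))

occ-last : ∀ {s} xs → last xs ≡ just s → 0 < occ s xs
occ-last {s} (x ∷ [])     refl = ≤-reflexive (sym (occ-here s []))
occ-last {s} (x ∷ y ∷ ys) eq   = ≤-trans (occ-last (y ∷ ys) eq) (occ-≤-∷ s x (y ∷ ys))

product≡∏-occ : ∀ lo k xs → All (InRange lo k) xs → product xs ≡ ∏[ lo ,+ k ] (λ x → x ^ occ x xs)
product≡∏-occ lo k []       []            = sym (∏-1 lo k)
product≡∏-occ lo k (y ∷ xs) (y∈ ∷ xs∈) = begin
  y * product xs                         ≡⟨ cong (y *_) (product≡∏-occ lo k xs xs∈) ⟩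
  y * ∏[ lo ,+ k ] (λ x → x ^ occ x xs)     ≡⟨ ∏-update _ _ y lo k y∈ (cong (y ^_) (occ-here y xs))
                                                  (λ x x≢y → cong (x ^_) (occ-there xs x≢y)) ⟨
  ∏[ lo ,+ k ] (λ x → x ^ occ x (y ∷ xs)) ∎
  where open ≡-Reasoning

withMultiplicity : (ℕ → ℕ) → ℕ → ℕ → List ℕ
withMultiplicity r lo zero    = []
withMultiplicity r lo (suc k) = replicate (r lo) lo ++ withMultiplicity r (suc lo) k

withMultiplicity-inRange : ∀ r lo k → All (InRange lo k) (withMultiplicity r lo k)
withMultiplicity-inRange r lo zero    = []
withMultiplicity-inRange r lo (suc k) = ++⁺ (replicate⁺ (r lo) (≤-refl , lo<lo+1+k))
  (All.map (λ { {y} (lo<y , y<1+lo+k) → <⇒≤ lo<y , subst (y <_) (sym (+-suc lo k)) y<1+lo+k })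
           (withMultiplicity-inRange r (suc lo) k))
  where
  lo<lo+1+k : lo < lo + suc k
  lo<lo+1+k = subst (lo <_) (sym (+-suc lo k)) (s≤s (m≤m+n lo k))

Linked-∷ : ∀ {x ys} → All (x ≤_) ys → Linked _≤_ ys → Linked _≤_ (x ∷ ys)
Linked-∷ []          _     = [-]
Linked-∷ (x≤y ∷ _) sorted = x≤y ∷ sorted

Linked-replicate-++ : ∀ x c {ys} → All (x ≤_) ys → Linked _≤_ ys → Linked _≤_ (replicate c x ++ ys)
Linked-replicate-++ x zero    x≤ys sorted = sorted
Linked-replicate-++ x (suc c) x≤ys sorted =
  Linked-∷ (++⁺ (replicate⁺ c ≤-refl) x≤ys) (Linked-replicate-++ x c x≤ys sorted)

withMultiplicity-sorted : ∀ r lo k → Linked _≤_ (withMultiplicity r lo k)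
withMultiplicity-sorted r lo zero    = []
withMultiplicity-sorted r lo (suc k) = Linked-replicate-++ lo (r lo)
  (All.map (λ (lo<y , _) → <⇒≤ lo<y) (withMultiplicity-inRange r (suc lo) k))
  (withMultiplicity-sorted r (suc lo) k)

occ-withMultiplicity : ∀ r x lo k → occ x (withMultiplicity r lo k) ≤ r x
occ-withMultiplicity r x lo zero    = z≤n
occ-withMultiplicity r x lo (suc k) with x ≟ lo
... | yes refl = ≤-reflexive (begin
  occ x (replicate (r x) x ++ rest)   ≡⟨ occ-++ x (replicate (r x) x) rest ⟩
  occ x (replicate (r x) x) + occ x rest ≡⟨ cong₂ _+_ (occ-replicate x (r x))
       (occ-absent (All.map (λ (x<y , _) → <⇒≢ x<y) (withMultiplicity-inRange r (suc x) k))) ⟩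
  r x + 0                             ≡⟨ +-identityʳ (r x) ⟩
  r x                                 ∎)
  where
  open ≡-Reasoning
  rest = withMultiplicity r (suc x) k
... | no x≢lo = begin
  occ x (replicate (r lo) lo ++ rest)    ≡⟨ occ-++ x (replicate (r lo) lo) rest ⟩
  occ x (replicate (r lo) lo) + occ x rest ≡⟨ cong (_+ occ x rest) (occ-absent (replicate⁺ (r lo) x≢lo)) ⟩
  occ x rest                             ≤⟨ occ-withMultiplicity r x (suc lo) k ⟩
  r x                                    ∎
  where
  open ≤-Reasoning
  rest = withMultiplicity r (suc lo) k

withMultiplicity-∷ : ∀ r lo k → r lo ≢ 0 → ∃[ rest ] withMultiplicity r lo (suc k) ≡ lo ∷ rest
withMultiplicity-∷ r lo k r-lo≢0 with r lo
... | zero  = contradiction refl r-lo≢0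
... | suc t = replicate t lo ++ withMultiplicity r (suc lo) k , refl

product-withMultiplicity : ∀ r lo k → product (withMultiplicity r lo k) ≡ ∏[ lo ,+ k ] (λ x → x ^ r x)
product-withMultiplicity r lo zero    = refl
product-withMultiplicity r lo (suc k) = trans (product-++ (replicate (r lo) lo) _)
  (cong₂ _*_ (product-replicate (r lo)) (product-withMultiplicity r (suc lo) k))
  where
  product-replicate : ∀ c → product (replicate c lo) ≡ lo ^ c
  product-replicate zero    = refl
  product-replicate (suc c) = cong (lo *_) (product-replicate c)

-- Reducing the exponents modulo m divides the product by Q ^ m, and Q ≢ 0 needs lo > 0.
isProductSeq-withMultiplicity-% : ∀ m .{{_ : NonZero m}} (c : ℕ → ℕ) lo k → 0 < lo →
  ∃[ U ] ∏[ lo ,+ k ] (λ x → x ^ c x) ≡ U ^ m →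
  IsProductSeq m (withMultiplicity (λ x → c x % m) lo k)
isProductSeq-withMultiplicity-% m c lo k 0<lo (U , ∏≡U^m) =
  withMultiplicity-sorted r lo k , *-^-cancel-power m (product L) Q U {{Q≢0}} productL*Q^m≡U^m ,
  λ x → ≤-<-trans (occ-withMultiplicity r x lo k) (m%n<n (c x) m)
  where
  r q : ℕ → ℕ
  r x = c x % m
  q x = c x / m
  L = withMultiplicity r lo k
  Q = ∏[ lo ,+ k ] (λ x → x ^ q x)
  Q≢0 : NonZero Q
  Q≢0 = ∏-nonZero _ lo k (λ x lo≤x → m^n≢0 x (q x) {{>-nonZero (<-≤-trans 0<lo lo≤x)}})
  x^c≡x^r*[x^q]^m : ∀ x → x ^ c x ≡ x ^ r x * (x ^ q x) ^ m
  x^c≡x^r*[x^q]^m x = begin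
    x ^ c x                 ≡⟨ cong (x ^_) (m≡m%n+[m/n]*n (c x) m) ⟩
    x ^ (r x + q x * m)     ≡⟨ ^-distribˡ-+-* x (r x) (q x * m) ⟩
    x ^ r x * x ^ (q x * m) ≡⟨ cong (x ^ r x *_) (^-*-assoc x (q x) m) ⟨
    x ^ r x * (x ^ q x) ^ m ∎
    where open ≡-Reasoning
  productL*Q^m≡U^m : product L * Q ^ m ≡ U ^ m
  productL*Q^m≡U^m = begin
    product L * Q ^ m
      ≡⟨ cong₂ _*_ (product-withMultiplicity r lo k) (sym (∏-distrib-^ (λ x → x ^ q x) m lo k)) ⟩
    ∏[ lo ,+ k ] (λ x → x ^ r x) * ∏[ lo ,+ k ] (λ x → (x ^ q x) ^ m)
      ≡⟨ ∏-distrib-* (λ x → x ^ r x) (λ x → (x ^ q x) ^ m) lo k ⟨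
    ∏[ lo ,+ k ] (λ x → x ^ r x * (x ^ q x) ^ m)
      ≡⟨ ∏-cong lo k (λ x _ → x^c≡x^r*[x^q]^m x) ⟨
    ∏[ lo ,+ k ] (λ x → x ^ c x)
      ≡⟨ ∏≡U^m ⟩
    U ^ m
      ∎
    where open ≡-Reasoning

Linked⇒All-≤-last : ∀ {s} xs → Linked _≤_ xs → last xs ≡ just s → All (_≤ s) xs
Linked⇒All-≤-last (x ∷ [])     [-]            refl = ≤-refl ∷ []
Linked⇒All-≤-last (x ∷ y ∷ ys) (x≤y ∷ sorted) eq   with Linked⇒All-≤-last (y ∷ ys) sorted eq
... | y≤s ∷ ys≤s = ≤-trans x≤y y≤s ∷ y≤s ∷ ys≤s

reaches-bounded : ∀ {m n s} → ((rest , _) : Reaches m n s) → All (λ y → n ≤ y × y ≤ s) (n ∷ rest)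
reaches-bounded (rest , (sorted , _) , lastEq) =
  All.zip (Linked⇒All ≤-trans ≤-refl sorted , Linked⇒All-≤-last (_ ∷ rest) sorted lastEq)

reaches⇒≤ : ∀ {m n s} → Reaches m n s → n ≤ s
reaches⇒≤ seq with reaches-bounded seq
... | (_ , n≤s) ∷ _ = n≤s

last-< : ∀ {s} x xs → All (_< s) (x ∷ xs) → ∃[ s' ] last (x ∷ xs) ≡ just s' × s' < s
last-< x []       (x<s ∷ []) = x , refl , x<s
last-< x (y ∷ ys) (_ ∷ ys<s) = last-< y ys ys<s

reaches-zero : ∀ {m} → 1 < m → Reaches m 0 0
reaches-zero {suc _} 1<m =
  [] , ([-] , (0 , refl) , λ x → ≤-<-trans (length-filter (x ≟_) (0 ∷ [])) 1<m) , refl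

∏-occ-combination-power : ∀ {m R S} lo k i j xs ys → All (InRange lo k) xs → All (InRange lo k) ys →
  product xs ≡ R ^ m → product ys ≡ S ^ m →
  ∏[ lo ,+ k ] (λ x → x ^ (i * occ x xs + j * occ x ys)) ≡ (R ^ i * S ^ j) ^ m
∏-occ-combination-power {m} {R} {S} lo k i j xs ys xs∈ ys∈ xs≡R^m ys≡S^m = begin
  ∏[ lo ,+ k ] (λ x → x ^ (i * a x + j * b x))
    ≡⟨ ∏-cong lo k (λ x _ → split x) ⟩
  ∏[ lo ,+ k ] (λ x → (x ^ a x) ^ i * (x ^ b x) ^ j)
    ≡⟨ ∏-distrib-* (λ x → (x ^ a x) ^ i) (λ x → (x ^ b x) ^ j) lo k ⟩
  ∏[ lo ,+ k ] (λ x → (x ^ a x) ^ i) * ∏[ lo ,+ k ] (λ x → (x ^ b x) ^ j)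
    ≡⟨ cong₂ _*_ (∏-distrib-^ (λ x → x ^ a x) i lo k) (∏-distrib-^ (λ x → x ^ b x) j lo k) ⟩
  (∏[ lo ,+ k ] (λ x → x ^ a x)) ^ i * (∏[ lo ,+ k ] (λ x → x ^ b x)) ^ j
    ≡⟨ cong₂ (λ u v → u ^ i * v ^ j) (product≡∏-occ lo k xs xs∈) (product≡∏-occ lo k ys ys∈) ⟨
  product xs ^ i * product ys ^ j
    ≡⟨ cong₂ (λ u v → u ^ i * v ^ j) xs≡R^m ys≡S^m ⟩
  (R ^ m) ^ i * (S ^ m) ^ j
    ≡⟨ cong₂ _*_ (^-swap R m i) (^-swap S m j) ⟩
  (R ^ i) ^ m * (S ^ j) ^ m
    ≡⟨ ^-distribʳ-* (R ^ i) (S ^ j) m ⟨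
  (R ^ i * S ^ j) ^ m
    ∎
  where
  open ≡-Reasoning
  a b : ℕ → ℕ
  a x = occ x xs
  b x = occ x ys
  split : ∀ x → x ^ (i * a x + j * b x) ≡ (x ^ a x) ^ i * (x ^ b x) ^ j
  split x = begin
    x ^ (i * a x + j * b x)       ≡⟨ ^-distribˡ-+-* x (i * a x) (j * b x) ⟩
    x ^ (i * a x) * x ^ (j * b x) ≡⟨ cong₂ (λ u v → x ^ u * x ^ v) (*-comm i (a x)) (*-comm j (b x)) ⟩
    x ^ (a x * i) * x ^ (b x * j) ≡⟨ cong₂ _*_ (^-*-assoc x (a x) i) (^-*-assoc x (b x) j) ⟨
    (x ^ a x) ^ i * (x ^ b x) ^ j ∎

prime∤-* : ∀ {p a b} → Prime p → 0 < a → a < p → 0 < b → b < p → ¬ p ∣ a * b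
prime∤-* {a = a} {b} p-prime 0<a a<p 0<b b<p p∣ab with euclidsLemma a b p-prime p∣ab
... | inj₁ p∣a = >⇒∤ {{>-nonZero 0<a}} a<p p∣a
... | inj₂ p∣b = >⇒∤ {{>-nonZero 0<b}} b<p p∣b

∏-init-power : ∀ m f lo k T .{{_ : NonZero T}} → f (lo + k) ≡ T ^ m →
  ∃[ U ] ∏[ lo ,+ suc k ] f ≡ U ^ m → ∃[ U ] ∏[ lo ,+ k ] f ≡ U ^ m
∏-init-power m f lo k T f[lo+k]≡T^m (U , ∏≡U^m) = *-^-cancel-power m _ T U (begin
  ∏[ lo ,+ k ] f * T ^ m        ≡⟨ cong (∏[ lo ,+ k ] f *_) f[lo+k]≡T^m ⟨
  ∏[ lo ,+ k ] f * f (lo + k)   ≡⟨ ∏-suc f lo k ⟨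
  ∏[ lo ,+ suc k ] f            ≡⟨ ∏≡U^m ⟩
  U ^ m                         ∎)
  where open ≡-Reasoning

withMultiplicity-reaches : ∀ m r lo k → r lo ≢ 0 → IsProductSeq m (withMultiplicity r lo (suc k)) →
  ∃[ s ] s < lo + suc k × Reaches m lo s
withMultiplicity-reaches m r lo k r-lo≢0 L-productSeq
  with rest , L≡lo∷rest ← withMultiplicity-∷ r lo k r-lo≢0
  with s , lastL≡s , s<lo+1+k ←
         last-< lo rest (subst (All _) L≡lo∷rest (All.map proj₂ (withMultiplicity-inRange r lo (suc k))))
  = s , s<lo+1+k , rest , subst (IsProductSeq m) L≡lo∷rest L-productSeq , lastL≡s

reaches-shorter : ∀ {m n n' s} → Prime m → 0 < n → n < n' → Reaches m n s → Reaches m n' s →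
  ∃[ s' ] s' < s × Reaches m n s'
reaches-shorter {m} {n} {n'} {s} m-prime 0<n n<n'
    seqA@(as , (_ , (R , productA≡R^m) , occA<m) , _)
    seqB@(bs , (_ , (S , productB≡S^m) , occB<m) , lastB)
  = let s' , s'<n+K , seq = withMultiplicity-reaches m (λ x → c x % m) n D c-n%m≢0 L-productSeq
    in s' , subst (s' <_) n+K≡s s'<n+K , seq
  where
  instance
    m≢0 : NonZero m
    m≢0 = prime⇒nonZero m-prime
  A = n ∷ as
  B = n' ∷ bs
  n<s = <-≤-trans n<n' (reaches⇒≤ seqB)
  D = proj₁ (m≤n⇒∃[o]m+o≡n n<s)
  K = suc D
  n+K≡s : n + K ≡ s
  n+K≡s = trans (+-suc n D) (proj₂ (m≤n⇒∃[o]m+o≡n n<s))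
  inRange : ∀ {y} → n ≤ y × y ≤ s → InRange n (suc K) y
  inRange {y} (n≤y , y≤s) = n≤y , subst (y <_) (sym (trans (+-suc n K) (cong suc n+K≡s))) (s≤s y≤s)
  B>n : All (n <_) B
  B>n = All.map (λ (n'≤y , _) → <-≤-trans n<n' n'≤y) (reaches-bounded seqB)
  a b c : ℕ → ℕ
  a x = occ x A
  b x = occ x B
  j = b s
  i = m ∸ a s
  c x = j * a x + i * b x
  c-s : c s ≡ j * m
  c-s = begin
    j * a s + i * j   ≡⟨ cong (_+ i * j) (*-comm j (a s)) ⟩
    a s * j + i * j   ≡⟨ *-distribʳ-+ j (a s) i ⟨
    (a s + i) * j     ≡⟨ cong (_* j) (m+[n∸m]≡n (<⇒≤ (occA<m s))) ⟩
    m * j             ≡⟨ *-comm m j ⟩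
    j * m             ∎
    where open ≡-Reasoning
  c-n : c n ≡ j * a n
  c-n = begin
    j * a n + i * b n ≡⟨ cong (λ z → j * a n + i * z) (occ-absent (All.map <⇒≢ B>n)) ⟩
    j * a n + i * 0   ≡⟨ cong (j * a n +_) (*-zeroʳ i) ⟩
    j * a n + 0       ≡⟨ +-identityʳ (j * a n) ⟩
    j * a n           ∎
    where open ≡-Reasoning
  [n+K]^c≡[s^j]^m : (n + K) ^ c (n + K) ≡ (s ^ j) ^ m
  [n+K]^c≡[s^j]^m = begin
    (n + K) ^ c (n + K) ≡⟨ cong (λ z → z ^ c z) n+K≡s ⟩
    s ^ c s             ≡⟨ cong (s ^_) c-s ⟩
    s ^ (j * m)         ≡⟨ ^-*-assoc s j m ⟨
    (s ^ j) ^ m         ∎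
    where open ≡-Reasoning
  ∏c-power : ∃[ U ] ∏[ n ,+ K ] (λ x → x ^ c x) ≡ U ^ m
  ∏c-power = ∏-init-power m (λ x → x ^ c x) n K (s ^ j) {{s^j≢0}} [n+K]^c≡[s^j]^m
    (R ^ j * S ^ i , ∏-occ-combination-power {m} n (suc K) j i A B A∈ B∈ productA≡R^m productB≡S^m)
    where
    s^j≢0 = m^n≢0 s j {{>-nonZero (<-≤-trans 0<n (reaches⇒≤ seqA))}}
    A∈ = All.map inRange (reaches-bounded seqA)
    B∈ = All.map (λ (n'≤y , y≤s) → inRange (<⇒≤ (<-≤-trans n<n' n'≤y) , y≤s)) (reaches-bounded seqB)
  L-productSeq : IsProductSeq m (withMultiplicity (λ x → c x % m) n K)
  L-productSeq = isProductSeq-withMultiplicity-% m c n K 0<n ∏c-power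
  c-n%m≢0 : c n % m ≢ 0
  c-n%m≢0 c-n%m≡0 =
    prime∤-* m-prime (occ-last B lastB) (occB<m s) (subst (0 <_) (sym (occ-here n as)) z<s) (occA<m n)
             (subst (m ∣_) c-n (m%n≡0⇒n∣m (c n) m c-n%m≡0))

IsG-<⇒¬IsG : ∀ {m n n' s} → Prime m → n < n' → IsG m n s → ¬ IsG m n' s
IsG-<⇒¬IsG {m} {n = zero} m-prime 0<n' (_ , least) (seq' , _) =
  <⇒≱ 0<n' (≤-trans (reaches⇒≤ seq') (least 0 (reaches-zero (nonTrivial⇒n>1 m {{prime⇒nonTrivial m-prime}}))))
IsG-<⇒¬IsG {n = suc _} m-prime n<n' (seq , least) (seq' , _)
  with s' , s'<s , seq'' ← reaches-shorter m-prime z<s n<n' seq seq' = <⇒≱ s'<s (least s' seq'')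

theorem5p1 : ∀ (m : ℕ) → Prime m →
    ∀ (n n' s : ℕ) → IsG m n s → IsG m n' s → n ≡ n'
theorem5p1 m m-prime n n' s gn gn' with <-cmp n n'
... | tri< n<n' _ _ = contradiction gn' (IsG-<⇒¬IsG m-prime n<n' gn)
... | tri≈ _ n≡n' _ = n≡n'
... | tri> _ _ n'<n = contradiction gn (IsG-<⇒¬IsG m-prime n'<n gn')
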